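{- Let $Z\in\{H,V\}^k$ contain $h$ occurrences of $H$ and $v$ occurrences of $V$, and let $B_1,B_2,B_3$ be $Z$-blocks with $B_2^+=B_1^++(h,v)$ and $B_3^+=B_2^++(h,v)$. Let $T_1=(P_1,c_1)$ and $T_2=(P_2,c_2)$ be $Z$-bridges, both positive or both negative, with $T_1$ connecting $B_1$ to $B_2$ and $T_2$ connecting $B_2$ to $B_3$ (so $P_1(k)=P_2(0)$). Let $\tilde c$ be a configuration with $\tilde c(P_1(0))=4$, $\tilde c(x)=3$ for every $x\in(P_1\cup P_2)\setminus\{P_1(0)\}$, and $\tilde c(x)<4$ for every other cell $x$. Then $F^2(\tilde c,Z)(P_2(k))=4$.
   Context: Cells are $\mathbb{Z}^2$; $H=(1,0)$, $V=(0,1)$ (second coordinate increasing downward). Configurations are maps $c:\mathbb{Z}^2\to\{0,\dots,5\}$; updates: $F(c,H)(x)=c(x)-2[c(x)\ge4]+[c(x+H)\ge4]+[c(x-H)\ge4]$, and $F(c,V)$ likewise with $V$. For $Z=Z(1)\cdots Z(k)$: $F(c,Z,0)=c$, $F(c,Z,s)=F(F(c,Z,s-1),Z(((s-1)\bmod k)+1))$, and $F^i(c,Z)=F(c,Z,ik)$. $Z$-blocks: the rectangles $a+(ih,jv)+\{0,\dots,h-1\}\times\{0,\dots,v-1\}$ of a fixed partition of $\mathbb{Z}^2$; $B^+$ is the upper-left cell of block $B$ and $B^-=B^++(0,v-1)$ its lower-left cell. A $Z$-path is $P=(P(0),\dots,P(l))$, $l\le k$, such that for some $\alpha,\beta\in\{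 -1,1\}$ and all $1\le s\le l$, $P(s)=P(s-1)+\alpha H$ if $Z(s)=H$ and $P(s)=P(s-1)+\beta V$ if $Z(s)=V$. A $Z$-bridge connecting blocks $B,B'$ with $B'^+=B^+ +(\pm h,\pm v)$ is a pair $(P,c)$ where $P=(P(0),\dots,P(k))$ is a $Z$-path with $(P(0),P(k))=(B^+,B'^+)$ (positive) or $(B^-,B'^-)$ (negative), and $c=3$ on $P$, $0$ elsewhere. -}

module Defs where

open import Data.Nat as ℕ using (ℕ; zero; suc; _≤ᵇ_)
open import Data.Integer as ℤ using (ℤ; +_; 1ℤ; -1ℤ)
open import Data.Bool using (if_then_else_)
open import Data.Product using (_×_; _,_; ∃; ∃-syntax; proj₁; proj₂)
open import Data.Sum using (_⊎_)
open import Data.List using (List; []; _∷_; length; foldl; lookup)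
open import Data.Fin using (Fin; inject₁; fromℕ)
open import Relation.Binary.PropositionalEquality using (_≡_)
open import Relation.Nullary using (¬_)

-- Cells of ℤ²: (first coordinate, second coordinate increasing downward)
Cell : Set
Cell = ℤ × ℤ

_⊕_ : Cell → Cell → Cell
(a , b) ⊕ (c , d) = (a ℤ.+ c , b ℤ.+ d)

data Dir : Set where
  H V : Dir

vec : Dir → Cell
vec H = (1ℤ , + 0)
vec V = (+ 0 , 1ℤ)

neg : Cell → Cell
neg (a , b) = (ℤ.- a , ℤ.- b)

-- Configurations (values in ℕ; all configurations in the statement take values ≤ 4)
Config : Set
Config = Cell → ℕ

ind : ℕ → ℕ
ind n = if 4 ≤ᵇ n then 1 else 0

-- F(c,D)(x) = c(x) - 2[c(x)≥4] + [c(x+D)≥4] + [c(x-D)≥4]   (the ∸ never truncates)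
step : Config → Dir → Config
step c d x = (c x ℕ.∸ 2 ℕ.* ind (c x)) ℕ.+ ind (c (x ⊕ vec d)) ℕ.+ ind (c (x ⊕ neg (vec d)))

applyZ : Config → List Dir → Config
applyZ c Z = foldl step c Z

Fpow : ℕ → Config → List Dir → Config
Fpow zero    c Z = c
Fpow (suc i) c Z = applyZ (Fpow i c Z) Z

countH : List Dir → ℕ
countH []       = 0
countH (H ∷ Z) = suc (countH Z)
countH (V ∷ Z) = countH Z

countV : List Dir → ℕ
countV []       = 0
countV (H ∷ Z) = countV Z
countV (V ∷ Z) = suc (countV Z)

-- b is the upper-left cell B⁺ of a block of the partition with offset a and block size h × v
IsBlockCorner : Cell → ℕ → ℕ → Cell → Set
IsBlockCorner a h v b = ∃[ i ] ∃[ j ] b ≡ a ⊕ (i ℤ.* + h , j ℤ.* + v)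

lowerLeft : ℕ → Cell → Cell
lowerLeft v b = b ⊕ (+ 0 , + v ℤ.- 1ℤ)

IsUnitSign : ℤ → Set
IsUnitSign α = (α ≡ 1ℤ) ⊎ (α ≡ -1ℤ)

move : ℤ → ℤ → Dir → Cell
move α β H = (α , + 0)
move α β V = (+ 0 , β)

IsZPath : (Z : List Dir) → (Fin (suc (length Z)) → Cell) → Set
IsZPath Z P = ∃[ α ] ∃[ β ] IsUnitSign α × IsUnitSign β ×
  ((s : Fin (length Z)) → P (Data.Fin.suc s) ≡ P (inject₁ s) ⊕ move α β (lookup Z s))

OnPath : {k : ℕ} → (Fin (suc k) → Cell) → Cell → Set
OnPath P x = ∃[ s ] P s ≡ x

data Polarity : Set where
  positive negative : Polarity

endCell : Polarity → ℕ → Cell → Cell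
endCell positive v b = b
endCell negative v b = lowerLeft v b

IsZBridge : (Z : List Dir) → Polarity → Cell → Cell →
            (Fin (suc (length Z)) → Cell) → Config → Set
IsZBridge Z pol b b' P c =
  IsZPath Z P ×
  P Data.Fin.zero ≡ endCell pol (countV Z) b ×
  P (fromℕ (length Z)) ≡ endCell pol (countV Z) b' ×
  ((x : Cell) → OnPath P x → c x ≡ 3) ×
  ((x : Cell) → ¬ OnPath P x → c x ≡ 0)

{-# OPTIONS --safe #-}
-- Both bridges join blocks offset by (+h, +v) with h, v ≥ 1, so their Z-paths can only
-- step by +H and +V: together they form a staircase along Z Z on which the level
-- x₁ + x₂ rises by one per step. A 4 at the foot of a staircase of 3s, with every other
-- cell of at least its level below 4, climbs it: applying the next direction D topples the
-- 4 at p, which raises p + D from 3 to 4 and changes no other cell of level at least that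
-- of p + D, as their D-neighbours have level at least that of p and only p is unstable.
-- After the 2k moves of Z Z the 4 sits at P₂(k).
module Submission where

open import Defs
open import Data.Nat using (_≤_; _<_; suc; s≤s)
import Data.Nat.Properties as ℕP
open import Data.Integer using (ℤ; +_; 1ℤ)
import Data.Integer as ℤ
import Data.Integer.Properties as ℤP
open import Data.Integer.Solver using (module +-*-Solver)
open +-*-Solver using (solve; _:+_; _:*_; :-_; con; _:=_)
open import Algebra.Properties.AbelianGroup ℤP.+-0-abelianGroup using (∙-cancelˡ)
open import Data.Product using (_×_; _,_; proj₁; proj₂)
open import Data.Product.Properties using (≡-dec)
open import Data.Sum using (_⊎_; inj₁; inj₂)
open import Data.Unit using (⊤; tt)
open import Data.List using (List; []; _∷_; _++_; length; foldl; lookup)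
open import Data.List.Properties using (foldl-++)
open import Data.Fin using (Fin; zero; fromℕ; inject₁) renaming (suc to fsuc)
open import Data.Fin.Properties using (any?)
open import Relation.Binary.PropositionalEquality
  using (_≡_; _≢_; refl; sym; trans; cong; cong₂; cong-app; subst; module ≡-Reasoning)
open import Relation.Nullary using (¬_; Dec; yes; no)

open ≡-Reasoning

⊕-⊕-neg : ∀ x d → (x ⊕ d) ⊕ neg d ≡ x
⊕-⊕-neg (a , b) (c , e) = cong₂ _,_ (cancel a c) (cancel b e)
  where
  cancel : ∀ a c → (a ℤ.+ c) ℤ.- c ≡ a
  cancel = solve 2 (λ a c → (a :+ c) :+ :- c := a) refl

⊕-neg-⊕ : ∀ x d → (x ⊕ neg d) ⊕ d ≡ x
⊕-neg-⊕ (a , b) (c , e) = cong₂ _,_ (cancel a c) (cancel b e)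
  where
  cancel : ∀ a c → (a ℤ.- c) ℤ.+ c ≡ a
  cancel = solve 2 (λ a c → (a :+ :- c) :+ c := a) refl

⊕-cancelˡ : ∀ x {d e} → x ⊕ d ≡ x ⊕ e → d ≡ e
⊕-cancelˡ (a , b) {d₁ , d₂} {e₁ , e₂} eq =
  cong₂ _,_ (∙-cancelˡ a d₁ e₁ (cong proj₁ eq)) (∙-cancelˡ b d₂ e₂ (cong proj₂ eq))

level : Cell → ℤ
level (a , b) = a ℤ.+ b

level-⊕ : ∀ x y → level (x ⊕ y) ≡ level x ℤ.+ level y
level-⊕ (a , b) (c , d) = solve 4 (λ a b c d → (a :+ c) :+ (b :+ d) := (a :+ b) :+ (c :+ d)) refl a b c d

level-vec : ∀ D → level (vec D) ≡ 1ℤ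
level-vec H = refl
level-vec V = refl

level-neg-vec : ∀ D → level (neg (vec D)) ≡ ℤ.-1ℤ
level-neg-vec H = refl
level-neg-vec V = refl

level-step : ∀ x D → level (x ⊕ vec D) ≡ ℤ.suc (level x)
level-step x D = begin
  level (x ⊕ vec D)          ≡⟨ level-⊕ x (vec D) ⟩
  level x ℤ.+ level (vec D)  ≡⟨ cong (ℤ._+_ (level x)) (level-vec D) ⟩
  level x ℤ.+ 1ℤ             ≡⟨ ℤP.+-comm (level x) 1ℤ ⟩
  ℤ.suc (level x)            ∎

level-back : ∀ x D → level (x ⊕ neg (vec D)) ≡ ℤ.pred (level x)
level-back x D = begin
  level (x ⊕ neg (vec D))          ≡⟨ level-⊕ x (neg (vec D)) ⟩
  level x ℤ.+ level (neg (vec D))  ≡⟨ cong (ℤ._+_ (level x)) (level-neg-vec D) ⟩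
  level x ℤ.+ ℤ.-1ℤ                ≡⟨ ℤP.+-comm (level x) ℤ.-1ℤ ⟩
  ℤ.pred (level x)                 ∎

infix 4 _≼_ _≺_

_≼_ _≺_ : Cell → Cell → Set
x ≼ y = level x ℤ.≤ level y
x ≺ y = level x ℤ.< level y

≺⇒≢ : ∀ {x y} → x ≺ y → y ≢ x
≺⇒≢ x≺y y≡x = ℤP.<⇒≢ x≺y (cong level (sym y≡x))

≺-step : ∀ x D → x ≺ x ⊕ vec D
≺-step x D = ℤP.suc[i]≤j⇒i<j (ℤP.≤-reflexive (sym (level-step x D)))

≼⇒≺-step : ∀ x y D → x ≼ y → x ≺ y ⊕ vec D
≼⇒≺-step _ y D x≼y = ℤP.≤-<-trans x≼y (≺-step y D)

step-≼⇒≺ : ∀ x y D → x ⊕ vec D ≼ y → x ≺ y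
step-≼⇒≺ x y D x+D≼y = ℤP.suc[i]≤j⇒i<j (subst (ℤ._≤ level y) (level-step x D) x+D≼y)

≺⇒≼-back : ∀ x y D → x ≺ y → x ≼ y ⊕ neg (vec D)
≺⇒≼-back _ y D x≺y = subst (_ ℤ.≤_) (sym (level-back y D)) (ℤP.i<j⇒i≤pred[j] x≺y)

<4⇒ind≡0 : ∀ {n} → n < 4 → ind n ≡ 0
<4⇒ind≡0 {0} _ = refl
<4⇒ind≡0 {1} _ = refl
<4⇒ind≡0 {2} _ = refl
<4⇒ind≡0 {3} _ = refl
<4⇒ind≡0 {suc (suc (suc (suc _)))} (s≤s (s≤s (s≤s (s≤s ()))))

step-stable : ∀ c x D → c x < 4 → c (x ⊕ vec D) < 4 → c (x ⊕ neg (vec D)) < 4 →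
              step c D x ≡ c x
step-stable c x D here ahead behind
  rewrite <4⇒ind≡0 here | <4⇒ind≡0 ahead | <4⇒ind≡0 behind
  = trans (ℕP.+-identityʳ _) (ℕP.+-identityʳ (c x))

step-ignite : ∀ c x D → c x ≡ 3 → c (x ⊕ vec D) < 4 → c (x ⊕ neg (vec D)) ≡ 4 →
              step c D x ≡ 4
step-ignite c x D here ahead behind rewrite here | <4⇒ind≡0 ahead | behind = refl

SubcriticalAhead : Config → Cell → Set
SubcriticalAhead c p = ∀ x → p ≼ x → x ≢ p → c x < 4

subcritical-≺ : ∀ {c p} → SubcriticalAhead c p → ∀ x → p ≺ x → c x < 4
subcritical-≺ sub x p≺x = sub x (ℤP.<⇒≤ p≺x) (≺⇒≢ p≺x)

module Toppling {c : Config} {p : Cell} (D : Dir) (c-p≡4 : c p ≡ 4) (sub : SubcriticalAhead c p) where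

  unchanged-ahead : ∀ x → p ⊕ vec D ≼ x → x ≢ p ⊕ vec D → step c D x ≡ c x
  unchanged-ahead x p+D≼x x≢p+D =
    step-stable c x D (subcritical-≺ sub x p≺x)
      (subcritical-≺ sub (x ⊕ vec D) (≼⇒≺-step p x D (ℤP.<⇒≤ p≺x)))
      (sub (x ⊕ neg (vec D)) (≺⇒≼-back p x D p≺x) x-D≢p)
    where
    p≺x : p ≺ x
    p≺x = step-≼⇒≺ p x D p+D≼x
    -- the rear neighbour of x may lie at p's level, but it is not p itself
    x-D≢p : x ⊕ neg (vec D) ≢ p
    x-D≢p x-D≡p = x≢p+D (trans (sym (⊕-neg-⊕ x (vec D))) (cong (_⊕ vec D) x-D≡p))

  unchanged-beyond : ∀ x → p ⊕ vec D ≺ x → step c D x ≡ c x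
  unchanged-beyond x p+D≺x = unchanged-ahead x (ℤP.<⇒≤ p+D≺x) (≺⇒≢ p+D≺x)

  front-ignites : c (p ⊕ vec D) ≡ 3 → step c D (p ⊕ vec D) ≡ 4
  front-ignites three = step-ignite c (p ⊕ vec D) D three
    (subcritical-≺ sub _ (≼⇒≺-step p (p ⊕ vec D) D (ℤP.<⇒≤ (≺-step p D))))
    (trans (cong c (⊕-⊕-neg p (vec D))) c-p≡4)

  subcritical-ahead : SubcriticalAhead (step c D) (p ⊕ vec D)
  subcritical-ahead x p+D≼x x≢p+D = subst (_< 4) (sym (unchanged-ahead x p+D≼x x≢p+D))
    (subcritical-≺ sub x (step-≼⇒≺ p x D p+D≼x))

walk : (Dir → Cell) → Cell → List Dir → Cell
walk m = foldl (λ q D → q ⊕ m D)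

Staircase : Config → Cell → List Dir → Set
Staircase c p []      = ⊤
Staircase c p (D ∷ W) = c (p ⊕ vec D) ≡ 3 × Staircase c (p ⊕ vec D) W

staircase-cong : ∀ W {c c′ p} → (∀ x → p ≺ x → c′ x ≡ c x) → Staircase c p W → Staircase c′ p W
staircase-cong []      _    _              = tt
staircase-cong (D ∷ W) {p = p} same (three , stairs) =
  trans (same _ (≺-step p D)) three ,
  staircase-cong W (λ x p+D≺x → same x (ℤP.<-trans (≺-step p D) p+D≺x)) stairs

staircase-++ : ∀ {c} p W₁ {W₂} → Staircase c p W₁ → Staircase c (walk vec p W₁) W₂ →
               Staircase c p (W₁ ++ W₂)
staircase-++ p []       _                 stairs₂ = stairs₂
staircase-++ p (D ∷ W₁) (three , stairs₁) stairs₂ =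
  three , staircase-++ (p ⊕ vec D) W₁ stairs₁ stairs₂

≼-walk : ∀ p W → p ≼ walk vec p W
≼-walk p []      = ℤP.≤-refl
≼-walk p (D ∷ W) = ℤP.≤-trans (ℤP.<⇒≤ (≺-step p D)) (≼-walk (p ⊕ vec D) W)

wave-climbs : ∀ W {c p} → c p ≡ 4 → SubcriticalAhead c p → Staircase c p W →
              foldl step c W (walk vec p W) ≡ 4
wave-climbs []      c-p≡4 _   _                = c-p≡4
wave-climbs (D ∷ W) c-p≡4 sub (three , stairs) =
  wave-climbs W (front-ignites three) subcritical-ahead (staircase-cong W unchanged-beyond stairs)
  where open Toppling D c-p≡4 sub

IsPathAlong : (Dir → Cell) → (Z : List Dir) → (Fin (suc (length Z)) → Cell) → Set
IsPathAlong m Z P = ∀ s → P (fsuc s) ≡ P (inject₁ s) ⊕ m (lookup Z s)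

path-end : ∀ {m} Z P → IsPathAlong m Z P → P (fromℕ (length Z)) ≡ walk m (P zero) Z
path-end         []      _ _     = refl
path-end {m} (D ∷ Z) P steps =
  trans (path-end Z (λ s → P (fsuc s)) (λ s → steps (fsuc s)))
        (cong (λ q → walk m q Z) (steps zero))

path-ascends : ∀ Z P → IsPathAlong vec Z P → ∀ s → P zero ≺ P (fsuc s)
path-ascends (D ∷ Z) P steps zero    = subst (P zero ≺_) (sym (steps zero)) (≺-step (P zero) D)
path-ascends (D ∷ Z) P steps (fsuc s) =
  ℤP.<-trans (path-ascends (D ∷ Z) P steps zero)
             (path-ascends Z (λ s → P (fsuc s)) (λ s → steps (fsuc s)) s)

path-staircase : ∀ Z P {c} → IsPathAlong vec Z P → (∀ s → c (P (fsuc s)) ≡ 3) →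
                 Staircase c (P zero) Z
path-staircase []      _ _     _      = tt
path-staircase (D ∷ Z) P {c} steps threes =
  subst (λ q → c q ≡ 3 × Staircase c q Z) (steps zero)
    (threes zero , path-staircase Z (λ s → P (fsuc s)) (λ s → steps (fsuc s))
                                    (λ s → threes (fsuc s)))

walk-move : ∀ α β Z p → walk (move α β) p Z ≡ p ⊕ (α ℤ.* + countH Z , β ℤ.* + countV Z)
walk-move α β []      (a , b) = cong₂ _,_ (no-move a α) (no-move b β)
  where
  no-move : ∀ a α → a ≡ a ℤ.+ α ℤ.* + 0
  no-move = solve 2 (λ a α → a := a :+ α :* con (+ 0)) refl
walk-move α β (D ∷ Z) p = trans (walk-move α β Z (p ⊕ move α β D)) (first-move D p)
  where
  h v : ℤ
  h = + countH Z
  v = + countV Z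
  moved : ∀ a α n → (a ℤ.+ α) ℤ.+ α ℤ.* n ≡ a ℤ.+ α ℤ.* (1ℤ ℤ.+ n)
  moved = solve 3 (λ a α n → (a :+ α) :+ α :* n := a :+ α :* (con 1ℤ :+ n)) refl
  kept : ∀ a α n → (a ℤ.+ + 0) ℤ.+ α ℤ.* n ≡ a ℤ.+ α ℤ.* n
  kept a α n = cong (ℤ._+ α ℤ.* n) (ℤP.+-identityʳ a)
  first-move : ∀ D p → (p ⊕ move α β D) ⊕ (α ℤ.* h , β ℤ.* v)
                     ≡ p ⊕ (α ℤ.* + countH (D ∷ Z) , β ℤ.* + countV (D ∷ Z))
  first-move H (a , b) = cong₂ _,_ (moved a α h) (kept b β v)
  first-move V (a , b) = cong₂ _,_ (kept a α h) (moved b β v)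

unitSign≡1 : ∀ {α n} → 1 ≤ n → IsUnitSign α → α ℤ.* + n ≡ + n → α ≡ 1ℤ
unitSign≡1 _           (inj₁ α≡1) _  = α≡1
unitSign≡1 (s≤s _) (inj₂ refl) ()

move-1-1 : ∀ D → move 1ℤ 1ℤ D ≡ vec D
move-1-1 H = refl
move-1-1 V = refl

zpath-ascending : ∀ Z P → 1 ≤ countH Z → 1 ≤ countV Z → IsZPath Z P →
                  P (fromℕ (length Z)) ≡ P zero ⊕ (+ countH Z , + countV Z) → IsPathAlong vec Z P
zpath-ascending Z P 1≤h 1≤v (α , β , ±α , ±β , steps) end
  with unitSign≡1 1≤h ±α (cong proj₁ displacement) | unitSign≡1 1≤v ±β (cong proj₂ displacement)
  where
  displacement : (α ℤ.* + countH Z , β ℤ.* + countV Z) ≡ (+ countH Z , + countV Z)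
  displacement = ⊕-cancelˡ (P zero)
    (trans (sym (trans (path-end Z P steps) (walk-move α β Z (P zero)))) end)
... | refl | refl = λ s → trans (steps s) (cong (P (inject₁ s) ⊕_) (move-1-1 (lookup Z s)))

endCell-⊕ : ∀ pol v b d → endCell pol v (b ⊕ d) ≡ endCell pol v b ⊕ d
endCell-⊕ positive v b       d       = refl
endCell-⊕ negative v (a , b) (c , d) = cong₂ _,_
  (solve 2 (λ a c → (a :+ c) :+ con (+ 0) := (a :+ con (+ 0)) :+ c) refl a c)
  (solve 3 (λ b d w → (b :+ d) :+ w := (b :+ w) :+ d) refl b d (+ v ℤ.- 1ℤ))

bridge-displacement : ∀ Z P pol b {b′ c} d → b′ ≡ b ⊕ d → IsZBridge Z pol b b′ P c →
                      P (fromℕ (length Z)) ≡ P zero ⊕ d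
bridge-displacement Z P pol b {b′} d b′≡b+d (_ , start , end , _) = begin
  P (fromℕ (length Z))      ≡⟨ end ⟩
  endCell pol v b′          ≡⟨ cong (endCell pol v) b′≡b+d ⟩
  endCell pol v (b ⊕ d)     ≡⟨ endCell-⊕ pol v b d ⟩
  endCell pol v b ⊕ d       ≡⟨ cong (_⊕ d) (sym start) ⟩
  P zero ⊕ d                ∎
  where v = countV Z

bridge-ascending : ∀ Z P pol b {b′ c} → 1 ≤ countH Z → 1 ≤ countV Z →
                   b′ ≡ b ⊕ (+ countH Z , + countV Z) → IsZBridge Z pol b b′ P c →
                   IsPathAlong vec Z P
bridge-ascending Z P pol b 1≤h 1≤v b′≡ bridge =
  zpath-ascending Z P 1≤h 1≤v (proj₁ bridge) (bridge-displacement Z P pol b _ b′≡ bridge)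

module Consecutive (Z : List Dir) (P₁ P₂ : Fin (suc (length Z)) → Cell)
                   (path₁ : IsPathAlong vec Z P₁) (path₂ : IsPathAlong vec Z P₂)
                   (joined : P₂ zero ≡ P₁ (fromℕ (length Z))) where

  junction : P₂ zero ≡ walk vec (P₁ zero) Z
  junction = trans joined (path-end Z P₁ path₁)

  consecutive-end : P₂ (fromℕ (length Z)) ≡ walk vec (P₁ zero) (Z ++ Z)
  consecutive-end = begin
    P₂ (fromℕ (length Z))            ≡⟨ path-end Z P₂ path₂ ⟩
    walk vec (P₂ zero) Z             ≡⟨ cong (λ q → walk vec q Z) junction ⟩
    walk vec (walk vec (P₁ zero) Z) Z ≡⟨ foldl-++ _ (P₁ zero) Z Z ⟨
    walk vec (P₁ zero) (Z ++ Z)      ∎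

  consecutive-staircase : ∀ {c} → (∀ x → OnPath P₁ x ⊎ OnPath P₂ x → x ≢ P₁ zero → c x ≡ 3) →
                          Staircase c (P₁ zero) (Z ++ Z)
  consecutive-staircase {c} threes = staircase-++ (P₁ zero) Z (path-staircase Z P₁ path₁ threes₁)
    (subst (λ q → Staircase c q Z) junction (path-staircase Z P₂ path₂ threes₂))
    where
    threes₁ : ∀ s → c (P₁ (fsuc s)) ≡ 3
    threes₁ s = threes _ (inj₁ (_ , refl)) (≺⇒≢ (path-ascends Z P₁ path₁ s))
    P₁≼P₂ : P₁ zero ≼ P₂ zero
    P₁≼P₂ = subst (P₁ zero ≼_) (sym junction) (≼-walk (P₁ zero) Z)
    threes₂ : ∀ s → c (P₂ (fsuc s)) ≡ 3
    threes₂ s = threes _ (inj₂ (_ , refl)) (≺⇒≢ (ℤP.≤-<-trans P₁≼P₂ (path-ascends Z P₂ path₂ s)))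

onPath? : ∀ {k} (P : Fin (suc k) → Cell) x → Dec (OnPath P x)
onPath? P x = any? (λ s → ≡-dec ℤP._≟_ ℤP._≟_ (P s) x)

subcritical-off-source : ∀ {k} {c : Config} {q : Cell} (P₁ P₂ : Fin (suc k) → Cell) →
  (∀ x → OnPath P₁ x ⊎ OnPath P₂ x → x ≢ q → c x ≡ 3) →
  (∀ x → ¬ OnPath P₁ x → ¬ OnPath P₂ x → c x < 4) →
  ∀ x → x ≢ q → c x < 4
subcritical-off-source P₁ P₂ threes quiet x x≢q with onPath? P₁ x | onPath? P₂ x
... | yes on₁ | _       = ℕP.≤-reflexive (cong suc (threes x (inj₁ on₁) x≢q))
... | no _    | yes on₂ = ℕP.≤-reflexive (cong suc (threes x (inj₂ on₂) x≢q))
... | no off₁ | no off₂ = quiet x off₁ off₂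

corollary1 : (Z : List Dir) (a b₁ b₂ b₃ : Cell) →
  1 ≤ countH Z → 1 ≤ countV Z →
  IsBlockCorner a (countH Z) (countV Z) b₁ →
  b₂ ≡ b₁ ⊕ (+ countH Z , + countV Z) →
  b₃ ≡ b₂ ⊕ (+ countH Z , + countV Z) →
  (pol : Polarity) (P₁ P₂ : Fin (suc (length Z)) → Cell) (c₁ c₂ : Config) →
  IsZBridge Z pol b₁ b₂ P₁ c₁ →
  IsZBridge Z pol b₂ b₃ P₂ c₂ →
  (c̃ : Config) →
  c̃ (P₁ zero) ≡ 4 →
  ((x : Cell) → (OnPath P₁ x ⊎ OnPath P₂ x) → x ≢ P₁ zero → c̃ x ≡ 3) →
  ((x : Cell) → ¬ OnPath P₁ x → ¬ OnPath P₂ x → c̃ x < 4) →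
  Fpow 2 c̃ Z (P₂ (fromℕ (length Z))) ≡ 4
corollary1 Z _ b₁ b₂ _ 1≤h 1≤v _ b₂≡ b₃≡ pol P₁ P₂ _ _
           T₁@(_ , _ , end₁ , _) T₂@(_ , start₂ , _) c̃ source threes quiet = begin
  Fpow 2 c̃ Z (P₂ (fromℕ (length Z)))                  ≡⟨ cong-app (foldl-++ step c̃ Z Z) _ ⟨
  foldl step c̃ (Z ++ Z) (P₂ (fromℕ (length Z)))      ≡⟨ cong (foldl step c̃ (Z ++ Z)) consecutive-end ⟩
  foldl step c̃ (Z ++ Z) (walk vec (P₁ zero) (Z ++ Z)) ≡⟨ wave-climbs (Z ++ Z) source subcritical
                                                           (consecutive-staircase threes) ⟩
  4                                                    ∎
  where
  open Consecutive Z P₁ P₂ (bridge-ascending Z P₁ pol b₁ 1≤h 1≤v b₂≡ T₁)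
                           (bridge-ascending Z P₂ pol b₂ 1≤h 1≤v b₃≡ T₂) (trans start₂ (sym end₁))
  subcritical : SubcriticalAhead c̃ (P₁ zero)
  subcritical x _ = subcritical-off-source P₁ P₂ threes quiet x
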